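{- Let $L:\mathcal{C}\to\mathcal{D}$ and $R:\mathcal{D}\to\mathcal{C}$ be functors with an adjunction $L\dashv R$ of unit $\eta:\mathrm{Id}\Rightarrow RL$ and counit $\varepsilon:LR\Rightarrow\mathrm{Id}$, let $M_1$ be an endofunctor of $\mathcal{C}$ and $M_2$ an endofunctor of $\mathcal{D}$, and let $\lambda:LM_1\Rightarrow M_2L$ and $\rho:RM_2\Rightarrow M_1R$ be natural transformations (not assumed to be distributive laws). Let $\tilde\lambda:M_1R\Rightarrow RM_2$ be the mate of $\lambda$, $\tilde\lambda_Y=RM_2\varepsilon_Y\circ R\lambda_{RY}\circ\eta_{M_1RY}$. Then the two equations $$\rho_{LX}\circ R\lambda_X\circ\eta_{M_1X}=M_1\eta_X\quad(\text{for all }X)\qquad\text{and}\qquad M_2\varepsilon_Y\circ\lambda_{RY}\circ L\rho_Y=\varepsilon_{M_2Y}\quad(\text{for all }Y)$$ hold if and only if $\rho$ is an isomorphism with inverse $\tilde\lambda$ (i.e. $\rho\circ\tilde\lambda=\mathrm{id}$ and $\tilde\lambda\circ\rho=\mathrm{id}$).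
   Context: Standard notions of adjunction (unit/counit satisfying the triangle identities $\varepsilon L\circ L\eta=\mathrm{id}_L$ and $R\varepsilon\circ\eta R=\mathrm{id}_R$) and natural transformations are assumed. -}

module Defs where

-- Hom-sets carry an equivalence relation _≈_ (the standard constructive
-- rendering of "equality of morphisms"), respected by composition.

open import Level using (Level; _⊔_) renaming (suc to lsuc)
open import Relation.Binary.Structures using (IsEquivalence)

record Category (o ℓ e : Level) : Set (lsuc (o ⊔ ℓ ⊔ e)) where
  infix  4 _≈_
  infixr 9 _∘_
  field
    Obj       : Set o
    _⇒_       : Obj → Obj → Set ℓ
    _≈_       : ∀ {A B} → A ⇒ B → A ⇒ B → Set e
    id        : ∀ {A} → A ⇒ A
    _∘_       : ∀ {A B C} → B ⇒ C → A ⇒ B → A ⇒ C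
    equiv     : ∀ {A B} → IsEquivalence (_≈_ {A} {B})
    assoc     : ∀ {A B C D} {f : A ⇒ B} {g : B ⇒ C} {h : C ⇒ D} →
                (h ∘ g) ∘ f ≈ h ∘ (g ∘ f)
    identityˡ : ∀ {A B} {f : A ⇒ B} → id ∘ f ≈ f
    identityʳ : ∀ {A B} {f : A ⇒ B} → f ∘ id ≈ f
    ∘-resp-≈  : ∀ {A B C} {f h : B ⇒ C} {g i : A ⇒ B} →
                f ≈ h → g ≈ i → f ∘ g ≈ h ∘ i

record Functor {o ℓ e o′ ℓ′ e′ : Level}
               (C : Category o ℓ e) (D : Category o′ ℓ′ e′)
               : Set (o ⊔ ℓ ⊔ e ⊔ o′ ⊔ ℓ′ ⊔ e′) where
  private
    module C = Category C
    module D = Category D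
  field
    F₀           : C.Obj → D.Obj
    F₁           : ∀ {A B} → A C.⇒ B → F₀ A D.⇒ F₀ B
    identity     : ∀ {A} → F₁ (C.id {A}) D.≈ D.id
    homomorphism : ∀ {X Y Z} {f : X C.⇒ Y} {g : Y C.⇒ Z} →
                   F₁ (g C.∘ f) D.≈ F₁ g D.∘ F₁ f
    F-resp-≈     : ∀ {A B} {f g : A C.⇒ B} → f C.≈ g → F₁ f D.≈ F₁ g

IdF : ∀ {o ℓ e} (C : Category o ℓ e) → Functor C C
IdF C = record
  { F₀ = λ A → A
  ; F₁ = λ f → f
  ; identity = IsEquivalence.refl equiv
  ; homomorphism = IsEquivalence.refl equiv
  ; F-resp-≈ = λ p → p
  }
  where open Category C

_∘F_ : ∀ {o ℓ e o′ ℓ′ e′ o″ ℓ″ e″}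
         {C : Category o ℓ e} {D : Category o′ ℓ′ e′} {E : Category o″ ℓ″ e″} →
       Functor D E → Functor C D → Functor C E
_∘F_ {E = E} G F = record
  { F₀ = λ A → G.F₀ (F.F₀ A)
  ; F₁ = λ f → G.F₁ (F.F₁ f)
  ; identity = IsEquivalence.trans (Category.equiv E) (G.F-resp-≈ F.identity) G.identity
  ; homomorphism = IsEquivalence.trans (Category.equiv E) (G.F-resp-≈ F.homomorphism) G.homomorphism
  ; F-resp-≈ = λ p → G.F-resp-≈ (F.F-resp-≈ p)
  }
  where
    module G = Functor G
    module F = Functor F

record NaturalTransformation {o ℓ e o′ ℓ′ e′ : Level}
         {C : Category o ℓ e} {D : Category o′ ℓ′ e′}
         (F G : Functor C D) : Set (o ⊔ ℓ ⊔ e ⊔ o′ ⊔ ℓ′ ⊔ e′) where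
  private
    module C = Category C
    module D = Category D
    module F = Functor F
    module G = Functor G
  field
    η       : ∀ X → F.F₀ X D.⇒ G.F₀ X
    commute : ∀ {X Y} (f : X C.⇒ Y) → η Y D.∘ F.F₁ f D.≈ G.F₁ f D.∘ η X

record Adjunction {o ℓ e o′ ℓ′ e′ : Level}
         {C : Category o ℓ e} {D : Category o′ ℓ′ e′}
         (L : Functor C D) (R : Functor D C) : Set (o ⊔ ℓ ⊔ e ⊔ o′ ⊔ ℓ′ ⊔ e′) where
  private
    module C = Category C
    module D = Category D
    module L = Functor L
    module R = Functor R
  field
    unit   : NaturalTransformation (IdF C) (R ∘F L)
    counit : NaturalTransformation (L ∘F R) (IdF D)
  module unit   = NaturalTransformation unit
  module counit = NaturalTransformation counit
  field
    zig : ∀ X → counit.η (L.F₀ X) D.∘ L.F₁ (unit.η X) D.≈ D.id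
    zag : ∀ Y → R.F₁ (counit.η Y) C.∘ unit.η (R.F₀ Y) C.≈ C.id

mate : ∀ {o ℓ e o′ ℓ′ e′}
         {C : Category o ℓ e} {D : Category o′ ℓ′ e′}
         {L : Functor C D} {R : Functor D C} →
       Adjunction L R →
       (M₁ : Functor C C) (M₂ : Functor D D) →
       NaturalTransformation (L ∘F M₁) (M₂ ∘F L) →
       ∀ Y → Category._⇒_ C (Functor.F₀ M₁ (Functor.F₀ R Y))
                            (Functor.F₀ R (Functor.F₀ M₂ Y))
mate {C = C} {R = R} adj M₁ M₂ lam Y =
  R.F₁ (M₂.F₁ (ε Y)) ∘ (R.F₁ (NaturalTransformation.η lam (R.F₀ Y)) ∘ η (M₁.F₀ (R.F₀ Y)))
  where
    open Category C
    module R = Functor R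
    module M₁ = Functor M₁
    module M₂ = Functor M₂
    η = NaturalTransformation.η (Adjunction.unit adj)
    ε = NaturalTransformation.η (Adjunction.counit adj)

open import Data.Product using (_×_)

module _ {o ℓ e o′ ℓ′ e′ : Level}
         {C : Category o ℓ e} {D : Category o′ ℓ′ e′}
         {L : Functor C D} {R : Functor D C}
         (adj : Adjunction L R)
         (M₁ : Functor C C) (M₂ : Functor D D)
         (lam : NaturalTransformation (L ∘F M₁) (M₂ ∘F L))
         (rho : NaturalTransformation (R ∘F M₂) (M₁ ∘F R)) where
  private
    open Category C using () renaming (_∘_ to _∘C_; _≈_ to _≈C_; id to idC)
    open Category D using () renaming (_∘_ to _∘D_; _≈_ to _≈D_; id to idD)
    open Functor L using () renaming (F₀ to L₀; F₁ to L₁)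
    open Functor R using () renaming (F₀ to R₀; F₁ to R₁)
    open Functor M₁ using () renaming (F₀ to M₁₀; F₁ to M₁₁)
    open Functor M₂ using () renaming (F₀ to M₂₀; F₁ to M₂₁)
    η = NaturalTransformation.η (Adjunction.unit adj)
    ε = NaturalTransformation.η (Adjunction.counit adj)
    λ′ = NaturalTransformation.η lam
    ρ = NaturalTransformation.η rho
    λ̃ = mate adj M₁ M₂ lam

  TwoEquations : Set (o ⊔ e ⊔ o′ ⊔ e′)
  TwoEquations =
    (∀ X → ρ (L₀ X) ∘C (R₁ (λ′ X) ∘C η (M₁₀ X)) ≈C M₁₁ (η X))
    × (∀ Y → M₂₁ (ε Y) ∘D (λ′ (R₀ Y) ∘D L₁ (ρ Y)) ≈D ε (M₂₀ Y))

  RhoInverseOfMate : Set (o′ ⊔ e)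
  RhoInverseOfMate =
    (∀ Y → ρ Y ∘C λ̃ Y ≈C idC) × (∀ Y → λ̃ Y ∘C ρ Y ≈C idC)

-- Transposing M₂ε ∘ λ_R ∘ Lg across the adjunction gives λ̃ ∘ g. With g = ρ, the
-- second equation and λ̃ ∘ ρ = id are transposes of each other, since ε_{M₂} transposes
-- to id. With g = M₁η and a triangle identity, the transpose of λ is λ̃_L ∘ M₁η, so
-- ρ ∘ λ̃ = id gives the first equation; conversely, naturality of ρ and the other
-- triangle identity turn the first equation at RY into ρ ∘ λ̃ = id.
module Submission where

open import Defs
open import Level using (Level)
open import Data.Product.Function.NonDependent.Propositional using (_×-⇔_)
open import Function.Bundles using (_⇔_; mk⇔)
open import Relation.Binary.Bundles using (Setoid)
open import Relation.Binary.Structures using (IsEquivalence)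
import Relation.Binary.Reasoning.Setoid as SetoidReasoning

module HomReasoning {o ℓ e} (C : Category o ℓ e) where
  open Category C

  hom-setoid : Obj → Obj → Setoid ℓ e
  hom-setoid A B = record { isEquivalence = equiv {A} {B} }

  module _ {A B : Obj} where
    open IsEquivalence (equiv {A} {B}) public
      using () renaming (refl to ≈-refl; sym to ≈-sym; trans to ≈-trans)
    open SetoidReasoning (hom-setoid A B) public

  infixr 4 refl⟩∘⟨_ _⟩∘⟨refl

  refl⟩∘⟨_ : ∀ {A B C} {h : B ⇒ C} {f g : A ⇒ B} → f ≈ g → h ∘ f ≈ h ∘ g
  refl⟩∘⟨ p = ∘-resp-≈ ≈-refl p

  _⟩∘⟨refl : ∀ {A B C} {h : A ⇒ B} {f g : B ⇒ C} → f ≈ g → f ∘ h ≈ g ∘ h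
  p ⟩∘⟨refl = ∘-resp-≈ p ≈-refl

module AdjunctionProperties {o ℓ e o′ ℓ′ e′ : Level}
    {C : Category o ℓ e} {D : Category o′ ℓ′ e′}
    {L : Functor C D} {R : Functor D C}
    (adj : Adjunction L R) where
  private
    module C = Category C
    module D = Category D
    module L = Functor L
    module R = Functor R
    open Adjunction adj
    open HomReasoning D

  Ladjunct : ∀ {X B} → L.F₀ X D.⇒ B → X C.⇒ R.F₀ B
  Ladjunct {X} f = R.F₁ f C.∘ unit.η X

  Radjunct-Ladjunct≈id : ∀ {X B} (f : L.F₀ X D.⇒ B) →
                         counit.η B D.∘ L.F₁ (Ladjunct f) D.≈ f
  Radjunct-Ladjunct≈id {X} {B} f = begin
    counit.η B D.∘ L.F₁ (R.F₁ f C.∘ unit.η X)            ≈⟨ refl⟩∘⟨ L.homomorphism ⟩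
    counit.η B D.∘ (L.F₁ (R.F₁ f) D.∘ L.F₁ (unit.η X))   ≈⟨ D.assoc ⟨
    (counit.η B D.∘ L.F₁ (R.F₁ f)) D.∘ L.F₁ (unit.η X)   ≈⟨ counit.commute f ⟩∘⟨refl ⟩
    (f D.∘ counit.η (L.F₀ X)) D.∘ L.F₁ (unit.η X)        ≈⟨ D.assoc ⟩
    f D.∘ (counit.η (L.F₀ X) D.∘ L.F₁ (unit.η X))        ≈⟨ refl⟩∘⟨ zig X ⟩
    f D.∘ D.id                                           ≈⟨ D.identityʳ ⟩
    f                                                    ∎

  Ladjunct-injective : ∀ {X B} {f g : L.F₀ X D.⇒ B} →
                       Ladjunct f C.≈ Ladjunct g → f D.≈ g
  Ladjunct-injective {f = f} {g} p = begin
    f                                       ≈⟨ Radjunct-Ladjunct≈id f ⟨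
    counit.η _ D.∘ L.F₁ (Ladjunct f)        ≈⟨ refl⟩∘⟨ L.F-resp-≈ p ⟩
    counit.η _ D.∘ L.F₁ (Ladjunct g)        ≈⟨ Radjunct-Ladjunct≈id g ⟩
    g                                       ∎

module MateProperties {o ℓ e o′ ℓ′ e′ : Level}
    {C : Category o ℓ e} {D : Category o′ ℓ′ e′}
    {L : Functor C D} {R : Functor D C}
    (adj : Adjunction L R)
    (M₁ : Functor C C) (M₂ : Functor D D)
    (lam : NaturalTransformation (L ∘F M₁) (M₂ ∘F L)) where
  private
    module C = Category C
    module D = Category D
    module L = Functor L
    module R = Functor R
    module M₁ = Functor M₁
    module M₂ = Functor M₂
    module lam = NaturalTransformation lam
    open Adjunction adj
    open AdjunctionProperties adj
    η = unit.η
    ε = counit.η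
    λ′ = lam.η
    λ̃ = mate adj M₁ M₂ lam

  Ladjunct-mate : ∀ {Z Y} (g : Z C.⇒ M₁.F₀ (R.F₀ Y)) →
                  Ladjunct (M₂.F₁ (ε Y) D.∘ (λ′ (R.F₀ Y) D.∘ L.F₁ g)) C.≈ λ̃ Y C.∘ g
  Ladjunct-mate {Z} {Y} g = begin
    R.F₁ (ε₂ D.∘ (λ′ _ D.∘ L.F₁ g)) C.∘ η Z               ≈⟨ R-hom₃ ⟩∘⟨refl ⟩
    (R.F₁ ε₂ C.∘ (R.F₁ (λ′ _) C.∘ R.F₁ (L.F₁ g))) C.∘ η Z  ≈⟨ C.assoc ⟩
    R.F₁ ε₂ C.∘ ((R.F₁ (λ′ _) C.∘ R.F₁ (L.F₁ g)) C.∘ η Z)  ≈⟨ refl⟩∘⟨ C.assoc ⟩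
    R.F₁ ε₂ C.∘ (R.F₁ (λ′ _) C.∘ (R.F₁ (L.F₁ g) C.∘ η Z))  ≈⟨ refl⟩∘⟨ refl⟩∘⟨ unit.commute g ⟨
    R.F₁ ε₂ C.∘ (R.F₁ (λ′ _) C.∘ (η _ C.∘ g))              ≈⟨ refl⟩∘⟨ C.assoc ⟨
    R.F₁ ε₂ C.∘ ((R.F₁ (λ′ _) C.∘ η _) C.∘ g)              ≈⟨ C.assoc ⟨
    λ̃ Y C.∘ g                                             ∎
    where
      open HomReasoning C
      ε₂ = M₂.F₁ (ε Y)
      R-hom₃ = ≈-trans R.homomorphism (refl⟩∘⟨ R.homomorphism)

  M₂ε∘λ∘LM₁η≈λ : ∀ X →
                 M₂.F₁ (ε (L.F₀ X)) D.∘ (λ′ (R.F₀ (L.F₀ X)) D.∘ L.F₁ (M₁.F₁ (η X))) D.≈ λ′ X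
  M₂ε∘λ∘LM₁η≈λ X = begin
    M₂.F₁ (ε _) D.∘ (λ′ _ D.∘ L.F₁ (M₁.F₁ (η X)))       ≈⟨ refl⟩∘⟨ lam.commute (η X) ⟩
    M₂.F₁ (ε _) D.∘ (M₂.F₁ (L.F₁ (η X)) D.∘ λ′ X)       ≈⟨ D.assoc ⟨
    (M₂.F₁ (ε _) D.∘ M₂.F₁ (L.F₁ (η X))) D.∘ λ′ X       ≈⟨ ≈-sym M₂.homomorphism ⟩∘⟨refl ⟩
    M₂.F₁ (ε _ D.∘ L.F₁ (η X)) D.∘ λ′ X                 ≈⟨ M₂.F-resp-≈ (zig X) ⟩∘⟨refl ⟩
    M₂.F₁ D.id D.∘ λ′ X                                 ≈⟨ M₂.identity ⟩∘⟨refl ⟩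
    D.id D.∘ λ′ X                                       ≈⟨ D.identityˡ ⟩
    λ′ X                                                ∎
    where open HomReasoning D

  Ladjunct-λ≈mate∘M₁η : ∀ X → Ladjunct (λ′ X) C.≈ λ̃ (L.F₀ X) C.∘ M₁.F₁ (η X)
  Ladjunct-λ≈mate∘M₁η X = begin
    Ladjunct (λ′ X)                                                      ≈⟨ R.F-resp-≈ (M₂ε∘λ∘LM₁η≈λ X) ⟩∘⟨refl ⟨
    Ladjunct (M₂.F₁ (ε _) D.∘ (λ′ _ D.∘ L.F₁ (M₁.F₁ (η X))))             ≈⟨ Ladjunct-mate (M₁.F₁ (η X)) ⟩
    λ̃ (L.F₀ X) C.∘ M₁.F₁ (η X)                                           ∎
    where open HomReasoning C

module RhoProperties {o ℓ e o′ ℓ′ e′ : Level}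
    {C : Category o ℓ e} {D : Category o′ ℓ′ e′}
    {L : Functor C D} {R : Functor D C}
    (adj : Adjunction L R)
    (M₁ : Functor C C) (M₂ : Functor D D)
    (lam : NaturalTransformation (L ∘F M₁) (M₂ ∘F L))
    (rho : NaturalTransformation (R ∘F M₂) (M₁ ∘F R)) where
  private
    module C = Category C
    module D = Category D
    module L = Functor L
    module R = Functor R
    module M₁ = Functor M₁
    module M₂ = Functor M₂
    module rho = NaturalTransformation rho
    open Adjunction adj
    open AdjunctionProperties adj
    open MateProperties adj M₁ M₂ lam
    open HomReasoning C
    η = unit.η
    ε = counit.η
    λ′ = NaturalTransformation.η lam
    ρ = rho.η
    λ̃ = mate adj M₁ M₂ lam

  first-equation⇔ρ∘mate≈id :
    (∀ X → ρ (L.F₀ X) C.∘ Ladjunct (λ′ X) C.≈ M₁.F₁ (η X)) ⇔ (∀ Y → ρ Y C.∘ λ̃ Y C.≈ C.id)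
  first-equation⇔ρ∘mate≈id = mk⇔ to from
    where
      to : (∀ X → ρ (L.F₀ X) C.∘ Ladjunct (λ′ X) C.≈ M₁.F₁ (η X)) → ∀ Y → ρ Y C.∘ λ̃ Y C.≈ C.id
      to first Y = begin
        ρ Y C.∘ (R.F₁ (M₂.F₁ (ε Y)) C.∘ Ladjunct (λ′ _))       ≈⟨ C.assoc ⟨
        (ρ Y C.∘ R.F₁ (M₂.F₁ (ε Y))) C.∘ Ladjunct (λ′ _)       ≈⟨ rho.commute (ε Y) ⟩∘⟨refl ⟩
        (M₁.F₁ (R.F₁ (ε Y)) C.∘ ρ _) C.∘ Ladjunct (λ′ _)       ≈⟨ C.assoc ⟩
        M₁.F₁ (R.F₁ (ε Y)) C.∘ (ρ _ C.∘ Ladjunct (λ′ _))       ≈⟨ refl⟩∘⟨ first (R.F₀ Y) ⟩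
        M₁.F₁ (R.F₁ (ε Y)) C.∘ M₁.F₁ (η (R.F₀ Y))              ≈⟨ M₁.homomorphism ⟨
        M₁.F₁ (R.F₁ (ε Y) C.∘ η (R.F₀ Y))                      ≈⟨ M₁.F-resp-≈ (zag Y) ⟩
        M₁.F₁ C.id                                             ≈⟨ M₁.identity ⟩
        C.id                                                   ∎

      from : (∀ Y → ρ Y C.∘ λ̃ Y C.≈ C.id) → ∀ X → ρ (L.F₀ X) C.∘ Ladjunct (λ′ X) C.≈ M₁.F₁ (η X)
      from ρ∘λ̃≈id X = begin
        ρ (L.F₀ X) C.∘ Ladjunct (λ′ X)                         ≈⟨ refl⟩∘⟨ Ladjunct-λ≈mate∘M₁η X ⟩
        ρ (L.F₀ X) C.∘ (λ̃ (L.F₀ X) C.∘ M₁.F₁ (η X))            ≈⟨ C.assoc ⟨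
        (ρ (L.F₀ X) C.∘ λ̃ (L.F₀ X)) C.∘ M₁.F₁ (η X)            ≈⟨ ρ∘λ̃≈id (L.F₀ X) ⟩∘⟨refl ⟩
        C.id C.∘ M₁.F₁ (η X)                                   ≈⟨ C.identityˡ ⟩
        M₁.F₁ (η X)                                            ∎

  second-equation⇔mate∘ρ≈id :
    (∀ Y → M₂.F₁ (ε Y) D.∘ (λ′ (R.F₀ Y) D.∘ L.F₁ (ρ Y)) D.≈ ε (M₂.F₀ Y))
      ⇔ (∀ Y → λ̃ Y C.∘ ρ Y C.≈ C.id)
  second-equation⇔mate∘ρ≈id = mk⇔
    (λ second Y → ≈-trans (≈-sym (Ladjunct-mate (ρ Y)))
                          (≈-trans (R.F-resp-≈ (second Y) ⟩∘⟨refl) (zag (M₂.F₀ Y))))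
    (λ λ̃∘ρ≈id Y → Ladjunct-injective
                    (≈-trans (Ladjunct-mate (ρ Y)) (≈-trans (λ̃∘ρ≈id Y) (≈-sym (zag (M₂.F₀ Y))))))

mainTheorem16 : ∀ {o ℓ e o′ ℓ′ e′ : Level}
    {C : Category o ℓ e} {D : Category o′ ℓ′ e′}
    {L : Functor C D} {R : Functor D C}
    (adj : Adjunction L R)
    (M₁ : Functor C C) (M₂ : Functor D D)
    (lam : NaturalTransformation (L ∘F M₁) (M₂ ∘F L))
    (rho : NaturalTransformation (R ∘F M₂) (M₁ ∘F R)) →
    TwoEquations adj M₁ M₂ lam rho ⇔ RhoInverseOfMate adj M₁ M₂ lam rho
mainTheorem16 adj M₁ M₂ lam rho = first-equation⇔ρ∘mate≈id ×-⇔ second-equation⇔mate∘ρ≈id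
  where open RhoProperties adj M₁ M₂ lam rho
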